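{- Let $G$ be a 2-connected bipartite outerplanar graph. Then $G$ is 4-truncated degree-AT, i.e. $G$ has an AT-orientation $D$ such that $d_D^+(v) \le \min\{4, d_G(v)\} - 1$ for every vertex $v$ of $G$.
   Context: Let $D$ be an orientation of a graph $G$. For a subset $H$ of arcs of $D$, $D[H]$ is the subdigraph formed by the arcs of $H$; it is an Eulerian subdigraph if $d^+_{D[H]}(v)=d^-_{D[H]}(v)$ for every vertex $v$ (the empty arc set counts). Let $\mathcal{E}_e(D)$ (resp. $\mathcal{E}_o(D)$) be the set of arc sets $H$ with $D[H]$ Eulerian and $|H|$ even (resp. odd). $D$ is an AT-orientation if $|\mathcal{E}_e(D)| \ne |\mathcal{E}_o(D)|$. For $f: V(G)\to\mathbb{N}$, $G$ is $f$-AT if it has an AT-orientation $D$ with $d_D^+(v)\le f(v)-1$ for every vertex $v$. For a positive integer $k$, $G$ is $k$-truncated degree-AT if $G$ is $f$-AT for $f(v)=\min\{k,d_G(v)\}$. -}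

module Defs where

open import Data.Nat using (ℕ; zero; suc; _+_; _<_; _≤_; _⊔_; _⊓_)
open import Data.Bool using (Bool; true; false; if_then_else_)
open import Data.Fin using (Fin; zero; suc)
open import Data.Fin.Properties using () renaming (_≟_ to _≟ᶠ_)
open import Data.Vec using (Vec; []; _∷_; lookup)
open import Data.List using (List; []; _∷_; map; _++_; length; filter)
open import Data.Product using (Σ; ∃; _×_; _,_; proj₁; proj₂)
open import Data.Sum using (_⊎_)
open import Relation.Nullary using (¬_; Dec; yes; no)
open import Relation.Nullary.Decidable using (⌊_⌋; _×-dec_)
open import Relation.Binary.PropositionalEquality using (_≡_; _≢_)
import Data.Nat as ℕ
open import Data.Fin.Properties using (all?)
open import Function using (Injective)

record Graph : Set where
  field
    n    : ℕ
    m    : ℕ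
    ends : Fin m → Fin n × Fin n

  EdgeBetween : Fin m → Fin n → Fin n → Set
  EdgeBetween i a b = (ends i ≡ (a , b)) ⊎ (ends i ≡ (b , a))

  field
    loopless : ∀ i → proj₁ (ends i) ≢ proj₂ (ends i)
    noMulti  : ∀ i j a b → EdgeBetween i a b → EdgeBetween j a b → i ≡ j

open Graph public

countF : (k : ℕ) → (Fin k → Bool) → ℕ
countF zero    p = 0
countF (suc k) p = (if p zero then 1 else 0) + countF k (λ i → p (suc i))

isV : ∀ {n} → Fin n → Fin n → Bool
isV v w = ⌊ v ≟ᶠ w ⌋

deg : (G : Graph) → Fin (n G) → ℕ
deg G v = countF (m G) (λ i → isV v (proj₁ (ends G i)) Data.Bool.∨ isV v (proj₂ (ends G i)))

Orientation : Graph → Set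
Orientation G = Fin (m G) → Bool

tail head : (G : Graph) → Orientation G → Fin (m G) → Fin (n G)
tail G o i = if o i then proj₁ (ends G i) else proj₂ (ends G i)
head G o i = if o i then proj₂ (ends G i) else proj₁ (ends G i)

ArcSet : Graph → Set
ArcSet G = Vec Bool (m G)

outdegIn indegIn : (G : Graph) → Orientation G → ArcSet G → Fin (n G) → ℕ
outdegIn G o H v = countF (m G) (λ i → lookup H i Data.Bool.∧ isV v (tail G o i))
indegIn  G o H v = countF (m G) (λ i → lookup H i Data.Bool.∧ isV v (head G o i))

fullSet : (k : ℕ) → Vec Bool k
fullSet zero = []
fullSet (suc k) = true ∷ fullSet k

outdeg : (G : Graph) → Orientation G → Fin (n G) → ℕ
outdeg G o v = outdegIn G o (fullSet (m G)) v

Eulerian : (G : Graph) → Orientation G → ArcSet G → Set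
Eulerian G o H = ∀ v → outdegIn G o H v ≡ indegIn G o H v

eulerian? : (G : Graph) (o : Orientation G) (H : ArcSet G) → Dec (Eulerian G o H)
eulerian? G o H = all? (λ v → outdegIn G o H v ℕ.≟ indegIn G o H v)

allSubsets : (k : ℕ) → List (Vec Bool k)
allSubsets zero = [] ∷ []
allSubsets (suc k) = map (true ∷_) (allSubsets k) ++ map (false ∷_) (allSubsets k)

size : ∀ {k} → Vec Bool k → ℕ
size [] = 0
size (true ∷ H) = suc (size H)
size (false ∷ H) = size H

isEven : ℕ → Bool
isEven zero = true
isEven (suc k) = Data.Bool.not (isEven k)

EvenSize OddSize : ∀ {k} → Vec Bool k → Set
EvenSize H = isEven (size H) ≡ true
OddSize  H = isEven (size H) ≡ false

numEvenEulerian numOddEulerian : (G : Graph) → Orientation G → ℕ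
numEvenEulerian G o =
  length (filter (λ H → eulerian? G o H ×-dec (isEven (size H) Data.Bool.≟ true)) (allSubsets (m G)))
numOddEulerian G o =
  length (filter (λ H → eulerian? G o H ×-dec (isEven (size H) Data.Bool.≟ false)) (allSubsets (m G)))

IsATOrientation : (G : Graph) → Orientation G → Set
IsATOrientation G o = numEvenEulerian G o ≢ numOddEulerian G o

-- G is f-AT: AT-orientation with d⁺(v) ≤ f(v) - 1 (over ℤ), i.e. d⁺(v) < f(v)
IsFAT : (G : Graph) → (Fin (n G) → ℕ) → Set
IsFAT G f = Σ (Orientation G) λ o → IsATOrientation G o × (∀ v → outdeg G o v < f v)

TruncatedDegreeAT : ℕ → Graph → Set
TruncatedDegreeAT k G = IsFAT G (λ v → k ⊓ deg G v)

Adjacent : (G : Graph) → Fin (n G) → Fin (n G) → Set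
Adjacent G a b = ∃ λ i → EdgeBetween G i a b

data ReachAvoid (G : Graph) (x : Fin (n G)) : Fin (n G) → Fin (n G) → Set where
  here : ∀ {u} → ReachAvoid G x u u
  step : ∀ {u v w} → Adjacent G u v → v ≢ x → ReachAvoid G x v w → ReachAvoid G x u w

data Reach (G : Graph) : Fin (n G) → Fin (n G) → Set where
  here : ∀ {u} → Reach G u u
  step : ∀ {u v w} → Adjacent G u v → Reach G v w → Reach G u w

Connected : Graph → Set
Connected G = ∀ u w → Reach G u w

TwoConnected : Graph → Set
TwoConnected G =
  3 ≤ n G × Connected G ×
  (∀ x u w → u ≢ x → w ≢ x → ReachAvoid G x u w)

Bipartite : Graph → Set
Bipartite G = Σ (Fin (n G) → Bool) λ c → ∀ i → c (proj₁ (ends G i)) ≢ c (proj₂ (ends G i))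

-- Outerplanar (combinatorial form): the vertices can be placed in order around
-- a circle (pos injective) such that no two edges cross, i.e. there are no
-- edges ab, cd with pos a < pos c < pos b < pos d.
Outerplanar : Graph → Set
Outerplanar G =
  Σ (Fin (n G) → ℕ) λ pos → Injective _≡_ _≡_ pos ×
    (∀ i j a b c d → EdgeBetween G i a b → EdgeBetween G j c d →
       ¬ (pos a < pos c × pos c < pos b × pos b < pos d))

module Submission where

-- In a bipartite graph every Eulerian subdigraph has an even number of arcs: each arc has
-- exactly one black end, and at every black vertex in- and out-degree agree, so the arcs
-- number twice the out-degrees summed over black vertices. Hence every orientation is an
-- AT-orientation and only the degree bound matters. Order the vertices along the circle of
-- the outerplanar drawing. By 2-connectivity, consecutive vertices and the two extreme ones
-- are adjacent, so the circle is a Hamiltonian cycle; orienting it cyclically gives every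
-- vertex an in-arc, i.e. d⁺ ≤ d - 1. Every other edge is oriented away from its lower end
-- if it is the longest edge there, and away from its upper end otherwise. Because no edges
-- cross, a vertex is then the tail of at most one cycle edge, one longest chord and one
-- other chord, so d⁺ ≤ 3.

open import Data.Bool using (Bool; true; false; if_then_else_; _∧_; _∨_; T)
open import Data.Bool.Properties
  using (T-∧; ∧-identityʳ; ∧-zeroʳ; ∧-comm) renaming (_≟_ to _≟ᵇ_)
open import Data.Empty using (⊥; ⊥-elim)
open import Data.Fin using (Fin; zero; suc; fromℕ<)
open import Data.Fin.Properties using (any?; all?; ¬∀⟶∃¬) renaming (_≟_ to _≟ᶠ_)
open import Data.List using (length; filter; allFin)
open import Data.List.Extrema.Nat
  using (argmax; argmin; argmax-all; argmin-all; f[xs]≤f[argmax]; f[argmin]≤f[xs])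
open import Data.List.Membership.Propositional using (_∈_)
open import Data.List.Membership.Propositional.Properties
  using (∈-++⁺ʳ; ∈-map⁺; ∈-filter⁺; ∈-allFin)
open import Data.List.Properties using (filter-none; filter-some)
open import Data.List.Relation.Unary.All as All using (universal)
open import Data.List.Relation.Unary.All.Properties using (all-filter)
open import Data.List.Relation.Unary.Any as Any using (here)
open import Data.Nat using (ℕ; zero; suc; _+_; _*_; _≤_; _<_; z≤n; s≤s; _<?_; _≤?_)
open import Data.Nat.Properties
  using ( +-*-semiring; +-suc; +-comm; +-mono-≤; +-monoʳ-≤; *-identityˡ; *-identityʳ; ⊓-glb
        ; ≤-refl; ≤-trans; ≤-reflexive; ≤-antisym; n≤1+n; ≤-<-trans; <-≤-trans; <-trans
        ; <-irrefl; <-asym; <⇒≢; <⇒≱; ≮⇒≥; ≰⇒>; ≤∧≢⇒<; module ≤-Reasoning)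
open import Algebra.Properties.Semiring.Sum +-*-semiring
  using (sum-syntax; ∑-distrib-+; sum-cong-≗; sum-replicate-zero)
open import Data.Product using (∃; _×_; _,_; proj₁; proj₂)
open import Data.Sum using (_⊎_; inj₁; inj₂)
open import Data.Unit using (tt)
open import Data.Vec using (Vec; []; _∷_; lookup; replicate)
open import Data.Vec.Properties using (lookup-replicate)
open import Function using (Equivalence; Injective; _∘_)
open import Relation.Binary.PropositionalEquality
open import Relation.Nullary using (¬_; Dec; yes; no; contradiction)
open import Relation.Nullary.Decidable using (_×-dec_; _→-dec_; ¬?; T?; toWitness; fromWitness)
open import Relation.Unary using (Decidable)

open import Defs

-- Counting

𝟙 : Bool → ℕ
𝟙 b = if b then 1 else 0

countF≡∑𝟙 : ∀ k (p : Fin k → Bool) → countF k p ≡ ∑[ i < k ] 𝟙 (p i)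
countF≡∑𝟙 zero    p = refl
countF≡∑𝟙 (suc k) p = cong (𝟙 (p zero) +_) (countF≡∑𝟙 k (p ∘ suc))

countF-cong : ∀ k {p q : Fin k → Bool} → (∀ i → p i ≡ q i) → countF k p ≡ countF k q
countF-cong zero    p≗q = refl
countF-cong (suc k) p≗q = cong₂ _+_ (cong 𝟙 (p≗q zero)) (countF-cong k (p≗q ∘ suc))

countF-none : ∀ k {p : Fin k → Bool} → (∀ i → ¬ T (p i)) → countF k p ≡ 0
countF-none zero        none = refl
countF-none (suc k) {p} none with p zero | none zero
... | false | _  = countF-none k (none ∘ suc)
... | true  | ¬t = ⊥-elim (¬t _)

countF-mono : ∀ k {p q : Fin k → Bool} → (∀ i → T (p i) → T (q i)) → countF k p ≤ countF k q
countF-mono zero            p⇒q = z≤n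
countF-mono (suc k) {p} {q} p⇒q with p zero | q zero | p⇒q zero
... | false | false | _   = countF-mono k (p⇒q ∘ suc)
... | false | true  | _   = ≤-trans (countF-mono k (p⇒q ∘ suc)) (n≤1+n _)
... | true  | true  | _   = s≤s (countF-mono k (p⇒q ∘ suc))
... | true  | false | p⇒f = ⊥-elim (p⇒f _)

isV⇒≡ : ∀ {k} {v w : Fin k} → T (isV v w) → v ≡ w
isV⇒≡ = toWitness

isV-suc : ∀ {k} (c w : Fin k) → isV (suc c) (suc w) ≡ isV c w
isV-suc c w with c ≟ᶠ w
... | yes _ = refl
... | no  _ = refl

countF-isV : ∀ k (w : Fin k) → countF k (λ c → isV c w) ≡ 1
countF-isV (suc k) zero    = cong suc (countF-none k (λ _ ()))
countF-isV (suc k) (suc w) = trans (countF-cong k (λ c → isV-suc c w)) (countF-isV k w)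

countF-pos : ∀ k {p : Fin k → Bool} i → T (p i) → 1 ≤ countF k p
countF-pos k {p} i pᵢ = begin
  1                          ≡⟨ countF-isV k i ⟨
  countF k (λ c → isV c i)   ≤⟨ countF-mono k (λ c c≡i → subst (T ∘ p) (sym (isV⇒≡ c≡i)) pᵢ) ⟩
  countF k p                 ∎
  where open ≤-Reasoning

countF-atMostOne : ∀ k {p : Fin k → Bool} → (∀ i j → T (p i) → T (p j) → i ≡ j) → countF k p ≤ 1
countF-atMostOne k {p} unique with any? (λ i → T? (p i))
... | yes (i , pᵢ) = begin
  countF k p                 ≤⟨ countF-mono k (λ j pⱼ → fromWitness (unique j i pⱼ pᵢ)) ⟩
  countF k (λ c → isV c i)   ≡⟨ countF-isV k i ⟩
  1                          ∎
  where open ≤-Reasoning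
... | no  none     = ≤-trans (≤-reflexive (countF-none k (λ i pᵢ → none (i , pᵢ)))) z≤n

countF-split : ∀ k {p q r : Fin k → Bool} → (∀ i → 𝟙 (r i) ≡ 𝟙 (p i) + 𝟙 (q i)) →
  countF k r ≡ countF k p + countF k q
countF-split k {p} {q} {r} pointwise = begin
  countF k r                                ≡⟨ countF≡∑𝟙 k r ⟩
  ∑[ i < k ] 𝟙 (r i)                        ≡⟨ sum-cong-≗ pointwise ⟩
  ∑[ i < k ] (𝟙 (p i) + 𝟙 (q i))            ≡⟨ ∑-distrib-+ (𝟙 ∘ p) (𝟙 ∘ q) ⟩
  ∑[ i < k ] 𝟙 (p i) + ∑[ i < k ] 𝟙 (q i)
    ≡⟨ cong₂ _+_ (countF≡∑𝟙 k p) (countF≡∑𝟙 k q) ⟨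
  countF k p + countF k q                   ∎
  where open ≡-Reasoning

countF-∧ˡ : ∀ k b (p : Fin k → Bool) → countF k (λ i → b ∧ p i) ≡ 𝟙 b * countF k p
countF-∧ˡ k true  p = sym (*-identityˡ _)
countF-∧ˡ k false p = countF-none k (λ _ ())

countF-fibres : ∀ k {r} (κ : Fin k → Fin r) (p : Fin k → Bool) →
  countF k p ≡ ∑[ c < r ] countF k (λ i → p i ∧ isV c (κ i))
countF-fibres zero    {r} κ p = sym (sum-replicate-zero r)
countF-fibres (suc k) {r} κ p = begin
  𝟙 (p zero) + countF k (p ∘ suc)
    ≡⟨ cong₂ _+_ fibre-of-zero (countF-fibres k (κ ∘ suc) (p ∘ suc)) ⟩
  ∑[ c < r ] at-zero c + ∑[ c < r ] countF k (at-suc c)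
    ≡⟨ ∑-distrib-+ at-zero (λ c → countF k (at-suc c)) ⟨
  ∑[ c < r ] countF (suc k) (λ i → p i ∧ isV c (κ i))
    ∎
  where
  open ≡-Reasoning
  at-zero : Fin r → ℕ
  at-zero c = 𝟙 (p zero ∧ isV c (κ zero))
  at-suc : Fin r → Fin k → Bool
  at-suc c i = p (suc i) ∧ isV c (κ (suc i))
  fibre-of-zero : 𝟙 (p zero) ≡ ∑[ c < r ] 𝟙 (p zero ∧ isV c (κ zero))
  fibre-of-zero = begin
    𝟙 (p zero)                                     ≡⟨ *-identityʳ _ ⟨
    𝟙 (p zero) * 1                                 ≡⟨ cong (𝟙 (p zero) *_) (countF-isV r (κ zero)) ⟨
    𝟙 (p zero) * countF r (λ c → isV c (κ zero))   ≡⟨ countF-∧ˡ r (p zero) _ ⟨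
    countF r (λ c → p zero ∧ isV c (κ zero))       ≡⟨ countF≡∑𝟙 r _ ⟩
    ∑[ c < r ] 𝟙 (p zero ∧ isV c (κ zero))         ∎

countF-≤-injective : ∀ k {r} {p : Fin k → Bool} (κ : Fin k → Fin r) →
  (∀ i j → T (p i) → T (p j) → κ i ≡ κ j → i ≡ j) → countF k p ≤ r
countF-≤-injective k {r} {p} κ injective = begin
  countF k p                                      ≡⟨ countF-fibres k κ p ⟩
  ∑[ c < r ] countF k (λ i → p i ∧ isV c (κ i))
    ≤⟨ ∑-≤-length _ (λ c → countF-atMostOne k (unique c)) ⟩
  r                                               ∎
  where
  open ≤-Reasoning
  ∑-≤-length : ∀ {r} (f : Fin r → ℕ) → (∀ c → f c ≤ 1) → ∑[ c < r ] f c ≤ r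
  ∑-≤-length {zero}  f f≤1 = z≤n
  ∑-≤-length {suc r} f f≤1 = +-mono-≤ (f≤1 zero) (∑-≤-length (f ∘ suc) (f≤1 ∘ suc))
  unique : ∀ c i j → T (p i ∧ isV c (κ i)) → T (p j ∧ isV c (κ j)) → i ≡ j
  unique c i j tᵢ tⱼ with Equivalence.to T-∧ tᵢ | Equivalence.to T-∧ tⱼ
  ... | pᵢ , c≡κi | pⱼ , c≡κj = injective i j pᵢ pⱼ (trans (sym (isV⇒≡ c≡κi)) (isV⇒≡ c≡κj))

countF-preimage : ∀ k {r} (h : Fin k → Bool) (f : Fin r → Bool) (w : Fin k → Fin r) →
  countF k (λ i → h i ∧ f (w i)) ≡ ∑[ c < r ] (𝟙 (f c) * countF k (λ i → h i ∧ isV c (w i)))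
countF-preimage k h f w = trans (countF-fibres k w _) (sum-cong-≗ fibre)
  where
  restrict : ∀ b c x → (b ∧ f x) ∧ isV c x ≡ f c ∧ (b ∧ isV c x)
  restrict b c x with c ≟ᶠ x
  restrict b c .c | yes refl =
    trans (∧-identityʳ _) (trans (∧-comm b (f c)) (cong (f c ∧_) (sym (∧-identityʳ b))))
  restrict b c x  | no  _    =
    trans (∧-zeroʳ _) (sym (trans (cong (f c ∧_) (∧-zeroʳ b)) (∧-zeroʳ (f c))))
  fibre : ∀ c → countF k (λ i → (h i ∧ f (w i)) ∧ isV c (w i)) ≡
                𝟙 (f c) * countF k (λ i → h i ∧ isV c (w i))
  fibre c = trans (countF-cong k (λ i → restrict (h i) c (w i))) (countF-∧ˡ k (f c) _)

𝟙-∨ : ∀ a b → (T a → ¬ T b) → 𝟙 (a ∨ b) ≡ 𝟙 a + 𝟙 b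
𝟙-∨ false b     _    = refl
𝟙-∨ true  false _    = refl
𝟙-∨ true  true  a⇒¬b = ⊥-elim (a⇒¬b _ _)

𝟙-split : ∀ h x y → x ≢ y → 𝟙 h ≡ 𝟙 (h ∧ x) + 𝟙 (h ∧ y)
𝟙-split false x     y     _   = refl
𝟙-split true  false true  _   = refl
𝟙-split true  true  false _   = refl
𝟙-split true  false false x≢y = ⊥-elim (x≢y refl)
𝟙-split true  true  true  x≢y = ⊥-elim (x≢y refl)

lookup-fullSet : ∀ {k} (i : Fin k) → lookup (fullSet k) i ≡ true
lookup-fullSet zero    = refl
lookup-fullSet (suc i) = lookup-fullSet i

size≡countF : ∀ {k} (H : Vec Bool k) → size H ≡ countF k (lookup H)
size≡countF []          = refl
size≡countF (true ∷ H)  = cong suc (size≡countF H)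
size≡countF (false ∷ H) = size≡countF H

size-replicate-false : ∀ k → size (replicate k false) ≡ 0
size-replicate-false zero    = refl
size-replicate-false (suc k) = size-replicate-false k

replicate-false∈allSubsets : ∀ k → replicate k false ∈ allSubsets k
replicate-false∈allSubsets zero    = here refl
replicate-false∈allSubsets (suc k) = ∈-++⁺ʳ _ (∈-map⁺ (false ∷_) (replicate-false∈allSubsets k))

isEven-double : ∀ x → isEven (x + x) ≡ true
isEven-double zero    = refl
isEven-double (suc x) rewrite +-suc x x | isEven-double x = refl

module _ {k : ℕ} {P : Fin k → Set} (P? : Decidable P) (f : Fin k → ℕ) where

  private
    candidates = filter P? (allFin k)

    candidate : ∀ {j} → P j → j ∈ candidates
    candidate pⱼ = ∈-filter⁺ P? (∈-allFin _) pⱼ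

  -- Opaque: letting uses unfold the list computation makes typechecking very slow.
  opaque
    maximum-on : ∃ P → ∃ λ j → P j × ∀ j′ → P j′ → f j′ ≤ f j
    maximum-on (j₀ , pⱼ₀) =
      argmax f j₀ candidates , argmax-all f pⱼ₀ (all-filter P? (allFin k)) ,
      λ j′ pⱼ′ → All.lookup (f[xs]≤f[argmax] j₀ candidates) (candidate pⱼ′)

    minimum-on : ∃ P → ∃ λ j → P j × ∀ j′ → P j′ → f j ≤ f j′
    minimum-on (j₀ , pⱼ₀) =
      argmin f j₀ candidates , argmin-all f pⱼ₀ (all-filter P? (allFin k)) ,
      λ j′ pⱼ′ → All.lookup (f[argmin]≤f[xs] j₀ candidates) (candidate pⱼ′)

∃-≢₂ : ∀ {k} → 3 ≤ k → (a b : Fin k) → ∃ λ w → w ≢ a × w ≢ b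
∃-≢₂ (s≤s (s≤s (s≤s _))) zero          zero          = suc zero , (λ ()) , (λ ())
∃-≢₂ (s≤s (s≤s (s≤s _))) zero          (suc zero)    = suc (suc zero) , (λ ()) , (λ ())
∃-≢₂ (s≤s (s≤s (s≤s _))) zero          (suc (suc _)) = suc zero , (λ ()) , (λ ())
∃-≢₂ (s≤s (s≤s (s≤s _))) (suc zero)    zero          = suc (suc zero) , (λ ()) , (λ ())
∃-≢₂ (s≤s (s≤s (s≤s _))) (suc (suc _)) zero          = suc zero , (λ ()) , (λ ())
∃-≢₂ (s≤s (s≤s (s≤s _))) (suc _)       (suc _)       = zero , (λ ()) , (λ ())

-- Orientations, degrees and parity

module _ (G : Graph) where

  private
    V = Fin (n G)
    E = Fin (m G)

  EdgeBetween-sym : ∀ {i a b} → EdgeBetween G i a b → EdgeBetween G i b a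
  EdgeBetween-sym (inj₁ ab) = inj₂ ab
  EdgeBetween-sym (inj₂ ba) = inj₁ ba

  Adjacent-sym : ∀ {a b} → Adjacent G a b → Adjacent G b a
  Adjacent-sym (i , between) = i , EdgeBetween-sym between

  walk-exit : ∀ {x u w} {S : V → Set} → Decidable S → ReachAvoid G x u w → S u → ¬ S w →
    ∃ λ a → ∃ λ b → S a × ¬ S b × b ≢ x × Adjacent G a b
  walk-exit S? here                        su ¬sw = ⊥-elim (¬sw su)
  walk-exit S? (step {v = v} adj v≢x walk) su ¬sw with S? v
  ... | yes sv = walk-exit S? walk sv ¬sw
  ... | no ¬sv = _ , v , su , ¬sv , v≢x , adj

  orientFrom : (E → V) → Orientation G
  orientFrom t i = isV (t i) (proj₁ (ends G i))

  orientFrom-arc : ∀ t i {b} → EdgeBetween G i (t i) b →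
    tail G (orientFrom t) i ≡ t i × head G (orientFrom t) i ≡ b
  orientFrom-arc t i {b} between with ends G i | between | loopless G i
  ... | _ , _ | inj₁ refl | _ with t i ≟ᶠ t i
  ...   | yes _ = refl , refl
  ...   | no ≢t = ⊥-elim (≢t refl)
  orientFrom-arc t i {b} between | _ , _ | inj₂ refl | b≢t with t i ≟ᶠ b
  ...   | yes t≡b = ⊥-elim (b≢t (sym t≡b))
  ...   | no  _   = refl , refl

  indeg : Orientation G → V → ℕ
  indeg o = indegIn G o (fullSet (m G))

  outdeg+indeg≡deg : ∀ o v → outdeg G o v + indeg o v ≡ deg G v
  outdeg+indeg≡deg o v = sym (countF-split (m G) incidence)
    where
    ends-distinct : ∀ i → T (isV v (proj₁ (ends G i))) → ¬ T (isV v (proj₂ (ends G i)))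
    ends-distinct i v≡x v≡y = loopless G i (trans (sym (isV⇒≡ v≡x)) (isV⇒≡ v≡y))
    incidence : ∀ i → 𝟙 (isV v (proj₁ (ends G i)) ∨ isV v (proj₂ (ends G i))) ≡
      𝟙 (lookup (fullSet (m G)) i ∧ isV v (tail G o i)) +
      𝟙 (lookup (fullSet (m G)) i ∧ isV v (head G o i))
    incidence i rewrite lookup-fullSet i with o i
    ... | true  = 𝟙-∨ _ _ (ends-distinct i)
    ... | false = trans (𝟙-∨ _ _ (ends-distinct i)) (+-comm (𝟙 (isV v (proj₁ (ends G i)))) _)

  indeg≥1⇒outdeg<deg : ∀ o v → 1 ≤ indeg o v → outdeg G o v < deg G v
  indeg≥1⇒outdeg<deg o v indeg≥1 = begin
    suc (outdeg G o v)        ≡⟨ +-comm 1 (outdeg G o v) ⟩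
    outdeg G o v + 1          ≤⟨ +-monoʳ-≤ (outdeg G o v) indeg≥1 ⟩
    outdeg G o v + indeg o v  ≡⟨ outdeg+indeg≡deg o v ⟩
    deg G v                   ∎
    where open ≤-Reasoning

  indeg≥1-of-head : ∀ o i {v} → head G o i ≡ v → 1 ≤ indeg o v
  indeg≥1-of-head o i refl =
    countF-pos (m G) i (Equivalence.from T-∧ (subst T (sym (lookup-fullSet i)) _ , fromWitness refl))

  outdeg≤-byClasses : ∀ {r} o (κ : E → Fin r) →
    (∀ i j → tail G o i ≡ tail G o j → κ i ≡ κ j → i ≡ j) → ∀ v → outdeg G o v ≤ r
  outdeg≤-byClasses o κ injective v =
    countF-≤-injective (m G) κ (λ i j tᵢ tⱼ → injective i j (trans (sym (leaves tᵢ)) (leaves tⱼ)))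
    where
    leaves : ∀ {i} → T (lookup (fullSet (m G)) i ∧ isV v (tail G o i)) → v ≡ tail G o i
    leaves t = isV⇒≡ (proj₂ (Equivalence.to T-∧ t))

  bipartite-eulerian-even : Bipartite G → ∀ o H → Eulerian G o H → EvenSize H
  bipartite-eulerian-even (c , proper) o H balanced =
    subst (λ s → isEven s ≡ true) (sym size≡double) (isEven-double blackTails)
    where
    h = lookup H
    blackTails = ∑[ v < n G ] (𝟙 (c v) * outdegIn G o H v)
    one-black-end : ∀ i → c (tail G o i) ≢ c (head G o i)
    one-black-end i with o i
    ... | true  = proper i
    ... | false = proper i ∘ sym
    size≡double : size H ≡ blackTails + blackTails
    size≡double = begin
      size H
        ≡⟨ size≡countF H ⟩
      countF (m G) h
        ≡⟨ countF-split (m G) (λ i → 𝟙-split (h i) _ _ (one-black-end i)) ⟩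
      countF (m G) (λ i → h i ∧ c (tail G o i)) + countF (m G) (λ i → h i ∧ c (head G o i))
        ≡⟨ cong₂ _+_ (countF-preimage (m G) h c (tail G o)) (countF-preimage (m G) h c (head G o)) ⟩
      blackTails + ∑[ v < n G ] (𝟙 (c v) * indegIn G o H v)
        ≡⟨ cong (blackTails +_) (sum-cong-≗ (λ v → cong (𝟙 (c v) *_) (balanced v))) ⟨
      blackTails + blackTails
        ∎
      where open ≡-Reasoning

  empty-eulerian : ∀ o → Eulerian G o (replicate (m G) false)
  empty-eulerian o v = trans (countF-none (m G) (no-arc (λ i → isV v (tail G o i))))
                              (sym (countF-none (m G) (no-arc (λ i → isV v (head G o i)))))
    where
    no-arc : ∀ (x : E → Bool) i → ¬ T (lookup (replicate (m G) false) i ∧ x i)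
    no-arc x i = subst (λ b → ¬ T (b ∧ x i)) (sym (lookup-replicate i false)) (λ ())

  bipartite⇒AT : Bipartite G → ∀ o → IsATOrientation G o
  bipartite⇒AT bipartite o even≡odd = <⇒≢ some-even (sym (trans even≡odd no-odd))
    where
    no-odd : numOddEulerian G o ≡ 0
    no-odd = cong length (filter-none (λ H → eulerian? G o H ×-dec (isEven (size H) ≟ᵇ false))
      (universal not-odd (allSubsets (m G))))
      where
      not-odd : ∀ H → ¬ (Eulerian G o H × OddSize H)
      not-odd H (eulerian , odd) =
        contradiction (trans (sym (bipartite-eulerian-even bipartite o H eulerian)) odd) λ ()
    some-even : 0 < numEvenEulerian G o
    some-even = filter-some (λ H → eulerian? G o H ×-dec (isEven (size H) ≟ᵇ true))
      (Any.map (λ { refl → empty-eulerian o , cong isEven (size-replicate-false (m G)) })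
               (replicate-false∈allSubsets (m G)))

-- Outerplanar layouts

module Layout (G : Graph) (pos : Fin (n G) → ℕ) (pos-injective : Injective _≡_ _≡_ pos)
  (noncrossing : ∀ i j a b c d → EdgeBetween G i a b → EdgeBetween G j c d →
                 ¬ (pos a < pos c × pos c < pos b × pos b < pos d)) where

  private
    V = Fin (n G)
    E = Fin (m G)

  infix 4 _≺_ _⪯_ _≺?_ _⪯?_

  _≺_ _⪯_ : V → V → Set
  a ≺ b = pos a < pos b
  a ⪯ b = pos a ≤ pos b

  _≺?_ : ∀ a b → Dec (a ≺ b)
  a ≺? b = pos a <? pos b

  _⪯?_ : ∀ a b → Dec (a ⪯ b)
  a ⪯? b = pos a ≤? pos b

  ⪯-antisym : ∀ {a b} → a ⪯ b → b ⪯ a → a ≡ b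
  ⪯-antisym a⪯b b⪯a = pos-injective (≤-antisym a⪯b b⪯a)

  ⊀-antisym : ∀ {a b} → ¬ a ≺ b → ¬ b ≺ a → a ≡ b
  ⊀-antisym a⊀b b⊀a = ⪯-antisym (≮⇒≥ b⊀a) (≮⇒≥ a⊀b)

  ≺⇒≢ : ∀ {a b} → a ≺ b → a ≢ b
  ≺⇒≢ a≺b a≡b = <-irrefl (cong pos a≡b) a≺b

  ⪯∧≢⇒≺ : ∀ {a b} → a ⪯ b → a ≢ b → a ≺ b
  ⪯∧≢⇒≺ a⪯b a≢b = ≤∧≢⇒< a⪯b (a≢b ∘ pos-injective)

  ⊀∧≢⇒≻ : ∀ {a b} → ¬ a ≺ b → b ≢ a → b ≺ a
  ⊀∧≢⇒≻ a⊀b b≢a = ⪯∧≢⇒≺ (≮⇒≥ a⊀b) b≢a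

  outside-lopen : ∀ {a b c} → ¬ (a ≺ b × b ⪯ c) → b ≢ a → b ≺ a ⊎ c ≺ b
  outside-lopen {a} {b} b∉ b≢a with a ≺? b
  ... | yes a≺b = inj₂ (≰⇒> (λ b⪯c → b∉ (a≺b , b⪯c)))
  ... | no  a⊀b = inj₁ (⊀∧≢⇒≻ a⊀b b≢a)

  outside-ropen : ∀ {a b c} → ¬ (a ⪯ b × b ≺ c) → b ≢ c → b ≺ a ⊎ c ≺ b
  outside-ropen {a} {b} {c} b∉ b≢c with b ≺? c
  ... | yes b≺c = inj₁ (≰⇒> (λ a⪯b → b∉ (a⪯b , b≺c)))
  ... | no  b⊀c = inj₂ (⊀∧≢⇒≻ b⊀c (b≢c ∘ sym))

  -- Opaque: letting uses unfold the comparison inside lo and hi makes typechecking very slow.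
  opaque
    private
      sortPair : (x y : V) → Dec (x ≺ y) → V × V
      sortPair x y (yes _) = x , y
      sortPair x y (no  _) = y , x

    lo hi : E → V
    lo i = proj₁ (sortPair _ _ (proj₁ (ends G i) ≺? proj₂ (ends G i)))
    hi i = proj₂ (sortPair _ _ (proj₁ (ends G i) ≺? proj₂ (ends G i)))

    lo≺hi : ∀ i → lo i ≺ hi i
    lo≺hi i with proj₁ (ends G i) ≺? proj₂ (ends G i)
    ... | yes x≺y = x≺y
    ... | no  x⊀y = ⊀∧≢⇒≻ x⊀y (loopless G i ∘ sym)

    edge-lo-hi : ∀ i → EdgeBetween G i (lo i) (hi i)
    edge-lo-hi i with proj₁ (ends G i) ≺? proj₂ (ends G i)
    ... | yes _ = inj₁ refl
    ... | no  _ = inj₂ refl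

    lo-hi-of-edge : ∀ {i a b} → EdgeBetween G i a b → a ≺ b → lo i ≡ a × hi i ≡ b
    lo-hi-of-edge {i} {a} {b} between a≺b with ends G i | between
    ... | _ | inj₁ refl with a ≺? b
    ...   | yes _   = refl , refl
    ...   | no  a⊀b = ⊥-elim (a⊀b a≺b)
    lo-hi-of-edge {i} {a} {b} between a≺b | _ | inj₂ refl with b ≺? a
    ...   | yes b≺a = ⊥-elim (<-asym a≺b b≺a)
    ...   | no  _   = refl , refl

  edge-from-adjacent : ∀ {a b} → Adjacent G a b → a ≺ b → ∃ λ i → lo i ≡ a × hi i ≡ b
  edge-from-adjacent (i , between) a≺b = i , lo-hi-of-edge between a≺b

  edge-by-ends : ∀ {i j} → lo i ≡ lo j → hi i ≡ hi j → i ≡ j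
  edge-by-ends {i} {j} lo≡ hi≡ =
    noMulti G i j (lo i) (hi i) (edge-lo-hi i)
      (subst₂ (EdgeBetween G j) (sym lo≡) (sym hi≡) (edge-lo-hi j))

  no-interleaving : ∀ i j → lo i ≺ lo j → lo j ≺ hi i → hi i ≺ hi j → ⊥
  no-interleaving i j p q r = noncrossing i j _ _ _ _ (edge-lo-hi i) (edge-lo-hi j) (p , q , r)

  NothingBetween : V → V → Set
  NothingBetween a b = ∀ w → ¬ (a ≺ w × w ≺ b)

  Consecutive Extremal Longest : E → Set
  Consecutive i = NothingBetween (lo i) (hi i)
  Extremal i    = (∀ w → lo i ⪯ w) × (∀ w → w ⪯ hi i)
  Longest i     = ∀ j → lo j ≡ lo i → hi j ⪯ hi i

  consecutive? : Decidable Consecutive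
  consecutive? i = all? (λ w → ¬? ((lo i ≺? w) ×-dec (w ≺? hi i)))

  extremal? : Decidable Extremal
  extremal? i = all? (λ w → lo i ⪯? w) ×-dec all? (λ w → w ⪯? hi i)

  longest? : Decidable Longest
  longest? i = all? (λ j → (lo j ≟ᶠ lo i) →-dec (hi j ⪯? hi i))

  longer-edge : ∀ {i} → ¬ Longest i → ∃ λ j → lo j ≡ lo i × hi i ≺ hi j
  longer-edge {i} not-longest with ¬∀⟶∃¬ (m G) _ (λ j → (lo j ≟ᶠ lo i) →-dec (hi j ⪯? hi i))
                                                not-longest
  ... | j , ¬implication with lo j ≟ᶠ lo i
  ...   | yes same-lo = j , same-lo , ≰⇒> (λ hⱼ⪯hᵢ → ¬implication (λ _ → hⱼ⪯hᵢ))
  ...   | no  other   = ⊥-elim (¬implication (λ same-lo → ⊥-elim (other same-lo)))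

  -- Consecutive and extremal edges are the edges of the boundary cycle.
  data Shape (i : E) : Set where
    consecutive : Consecutive i → Shape i
    extremal    : ¬ Consecutive i → Extremal i → Shape i
    longest     : ¬ Consecutive i → ¬ Extremal i → Longest i → Shape i
    shorter     : ¬ Consecutive i → ¬ Extremal i → ¬ Longest i → Shape i

  shape : ∀ i → Shape i
  shape i with consecutive? i | extremal? i | longest? i
  ... | yes c | _     | _     = consecutive c
  ... | no ¬c | yes e | _     = extremal ¬c e
  ... | no ¬c | no ¬e | yes l = longest ¬c ¬e l
  ... | no ¬c | no ¬e | no ¬l = shorter ¬c ¬e ¬l

  tailOf headOf : ∀ {i} → Shape i → V
  tailOf {i} (consecutive _) = lo i
  tailOf {i} (extremal _ _)  = hi i
  tailOf {i} (longest _ _ _) = lo i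
  tailOf {i} (shorter _ _ _) = hi i
  headOf {i} (consecutive _) = hi i
  headOf {i} (extremal _ _)  = lo i
  headOf {i} (longest _ _ _) = hi i
  headOf {i} (shorter _ _ _) = lo i

  classOf : ∀ {i} → Shape i → Fin 3
  classOf (consecutive _) = zero
  classOf (extremal _ _)  = zero
  classOf (longest _ _ _) = suc zero
  classOf (shorter _ _ _) = suc (suc zero)

  shape-edge : ∀ {i} (s : Shape i) → EdgeBetween G i (tailOf s) (headOf s)
  shape-edge {i} (consecutive _) = edge-lo-hi i
  shape-edge {i} (extremal _ _)  = EdgeBetween-sym G (edge-lo-hi i)
  shape-edge {i} (longest _ _ _) = edge-lo-hi i
  shape-edge {i} (shorter _ _ _) = EdgeBetween-sym G (edge-lo-hi i)

  orientation : Orientation G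
  orientation = orientFrom G (tailOf ∘ shape)

  tail-orientation : ∀ i → tail G orientation i ≡ tailOf (shape i)
  tail-orientation i = proj₁ (orientFrom-arc G (tailOf ∘ shape) i (shape-edge (shape i)))

  head-orientation : ∀ i → head G orientation i ≡ headOf (shape i)
  head-orientation i = proj₂ (orientFrom-arc G (tailOf ∘ shape) i (shape-edge (shape i)))

  consecutive-from-same : ∀ {i j} → Consecutive i → Consecutive j → lo i ≡ lo j → i ≡ j
  consecutive-from-same {i} {j} cᵢ cⱼ lo≡ =
    edge-by-ends lo≡ (⊀-antisym (overshoots cⱼ lo≡) (overshoots cᵢ (sym lo≡)))
    where
    overshoots : ∀ {i j} → Consecutive j → lo i ≡ lo j → ¬ hi i ≺ hi j
    overshoots {i} {j} cⱼ lo≡ hᵢ≺hⱼ = cⱼ (hi i) (subst (_≺ hi i) lo≡ (lo≺hi i) , hᵢ≺hⱼ)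

  extremal-unique : ∀ {i j} → Extremal i → Extremal j → i ≡ j
  extremal-unique {i} {j} (lo-leastᵢ , hi-greatestᵢ) (lo-leastⱼ , hi-greatestⱼ) =
    edge-by-ends (⪯-antisym (lo-leastᵢ (lo j)) (lo-leastⱼ (lo i)))
                 (⪯-antisym (hi-greatestⱼ (hi i)) (hi-greatestᵢ (hi j)))

  extremal-hi≢lo : ∀ {i j} → Extremal j → lo i ≢ hi j
  extremal-hi≢lo {i} (_ , hi-greatest) lo≡hi =
    <⇒≱ (lo≺hi i) (subst (hi i ⪯_) (sym lo≡hi) (hi-greatest (hi i)))

  longest-from-same : ∀ {i j} → Longest i → Longest j → lo i ≡ lo j → i ≡ j
  longest-from-same {i} {j} lᵢ lⱼ lo≡ = edge-by-ends lo≡ (⪯-antisym (lⱼ i lo≡) (lᵢ j (sym lo≡)))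

  shorter-into-same : ∀ {i j} → ¬ Longest i → ¬ Longest j → hi i ≡ hi j → i ≡ j
  shorter-into-same {i} {j} ¬lᵢ ¬lⱼ hi≡ =
    edge-by-ends (⊀-antisym (crossing ¬lⱼ hi≡) (crossing ¬lᵢ (sym hi≡))) hi≡
    where
    -- a longer edge leaving lo j would cross i
    crossing : ∀ {i j} → ¬ Longest j → hi i ≡ hi j → ¬ lo i ≺ lo j
    crossing {i} {j} ¬lⱼ hi≡ loᵢ≺loⱼ with longer-edge ¬lⱼ
    ... | j′ , lo≡ , hⱼ≺hⱼ′ = no-interleaving i j′
      (subst (lo i ≺_) (sym lo≡) loᵢ≺loⱼ)
      (subst₂ _≺_ (sym lo≡) (sym hi≡) (lo≺hi j))
      (subst (_≺ hi j′) (sym hi≡) hⱼ≺hⱼ′)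

  tail-injective-in-class : ∀ {i j} (s : Shape i) (t : Shape j) →
    tailOf s ≡ tailOf t → classOf s ≡ classOf t → i ≡ j
  tail-injective-in-class (consecutive cᵢ)  (consecutive cⱼ)  tail≡ _ = consecutive-from-same cᵢ cⱼ tail≡
  tail-injective-in-class (consecutive _)   (extremal _ eⱼ)   tail≡ _ = ⊥-elim (extremal-hi≢lo eⱼ tail≡)
  tail-injective-in-class (extremal _ eᵢ)   (consecutive _)   tail≡ _ = ⊥-elim (extremal-hi≢lo eᵢ (sym tail≡))
  tail-injective-in-class (extremal _ eᵢ)   (extremal _ eⱼ)   _     _ = extremal-unique eᵢ eⱼ
  tail-injective-in-class (longest _ _ lᵢ)  (longest _ _ lⱼ)  tail≡ _ = longest-from-same lᵢ lⱼ tail≡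
  tail-injective-in-class (shorter _ _ ¬lᵢ) (shorter _ _ ¬lⱼ) tail≡ _ = shorter-into-same ¬lᵢ ¬lⱼ tail≡
  tail-injective-in-class (consecutive _)   (longest _ _ _)   _ ()
  tail-injective-in-class (consecutive _)   (shorter _ _ _)   _ ()
  tail-injective-in-class (extremal _ _)    (longest _ _ _)   _ ()
  tail-injective-in-class (extremal _ _)    (shorter _ _ _)   _ ()
  tail-injective-in-class (longest _ _ _)   (consecutive _)   _ ()
  tail-injective-in-class (longest _ _ _)   (extremal _ _)    _ ()
  tail-injective-in-class (longest _ _ _)   (shorter _ _ _)   _ ()
  tail-injective-in-class (shorter _ _ _)   (consecutive _)   _ ()
  tail-injective-in-class (shorter _ _ _)   (extremal _ _)    _ ()
  tail-injective-in-class (shorter _ _ _)   (longest _ _ _)   _ ()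

  outdeg≤3 : ∀ v → outdeg G orientation v ≤ 3
  outdeg≤3 = outdeg≤-byClasses G orientation (classOf ∘ shape) λ i j tail≡ →
    tail-injective-in-class (shape i) (shape j)
      (trans (sym (tail-orientation i)) (trans tail≡ (tail-orientation j)))

  head-of-consecutive : ∀ {i} (s : Shape i) → Consecutive i → headOf s ≡ hi i
  head-of-consecutive (consecutive _)  _ = refl
  head-of-consecutive (extremal ¬c _)  c = ⊥-elim (¬c c)
  head-of-consecutive (longest ¬c _ _) c = ⊥-elim (¬c c)
  head-of-consecutive (shorter ¬c _ _) c = ⊥-elim (¬c c)

  head-of-extremal : ∀ {i} (s : Shape i) → ¬ Consecutive i → Extremal i → headOf s ≡ lo i
  head-of-extremal (consecutive c)  ¬c _ = ⊥-elim (¬c c)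
  head-of-extremal (extremal _ _)   _  _ = refl
  head-of-extremal (longest _ ¬e _) _  e = ⊥-elim (¬e e)
  head-of-extremal (shorter _ ¬e _) _  e = ⊥-elim (¬e e)

  -- The boundary cycle of a 2-connected layout

  module _ (three : 3 ≤ n G)
           (connected-without : ∀ x u w → u ≢ x → w ≢ x → ReachAvoid G x u w) where

    module _ {u v : V} (u≺v : u ≺ v) (gap : NothingBetween u v) where

      private
        Spans : E → Set
        Spans j = lo j ⪯ u × v ⪯ hi j

        spans? : Decidable Spans
        spans? j = (lo j ⪯? u) ×-dec (v ⪯? hi j)

        beyond-gap : ∀ {b} → u ≺ b → v ⪯ b
        beyond-gap u≺b = ≮⇒≥ (λ b≺v → gap _ (u≺b , b≺v))

        before-gap : ∀ {b} → b ≺ v → b ⪯ u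
        before-gap b≺v = ≮⇒≥ (λ u≺b → gap _ (u≺b , b≺v))

        some-span : ∃ Spans
        some-span with ∃-≢₂ three u v
        ... | x , x≢u , x≢v
          with walk-exit G (_⪯? u) (connected-without x u v (≢-sym x≢u) (≢-sym x≢v))
                 ≤-refl (<⇒≱ u≺v)
        ...   | a , b , a⪯u , b⋠u , _ , adj with edge-from-adjacent adj (≤-<-trans a⪯u (≰⇒> b⋠u))
        ...     | j , refl , refl = j , a⪯u , beyond-gap (≰⇒> b⋠u)

        outermost = maximum-on spans? (pos ∘ lo) some-span
        innermost = minimum-on spans? (pos ∘ hi) some-span

        e₁ e₂ : E
        e₁ = proj₁ outermost
        e₂ = proj₁ innermost

        spans-e₁ : Spans e₁
        spans-e₁ = proj₁ (proj₂ outermost)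

        spans-e₂ : Spans e₂
        spans-e₂ = proj₁ (proj₂ innermost)

        e₁-outermost : ∀ j → Spans j → lo j ⪯ lo e₁
        e₁-outermost = proj₂ (proj₂ outermost)

        e₂-innermost : ∀ j → Spans j → hi e₂ ⪯ hi j
        e₂-innermost = proj₂ (proj₂ innermost)

        -- A walk from u to v avoiding lo e₁ has to leave the interval (lo e₁, u]; its exit edge
        -- would either cross e₁ or span the gap from a lower end right of lo e₁.
        lo-e₁ : lo e₁ ≡ u
        lo-e₁ = ⪯-antisym (proj₁ spans-e₁) (≮⇒≥ no-exit)
          where
          no-exit : ¬ lo e₁ ≺ u
          no-exit a*≺u
            with walk-exit G (λ w → (lo e₁ ≺? w) ×-dec (w ⪯? u))
                   (connected-without (lo e₁) u v (≢-sym (≺⇒≢ a*≺u))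
                                                  (≢-sym (≺⇒≢ (<-trans a*≺u u≺v))))
                   (a*≺u , ≤-refl) (λ (_ , v⪯u) → <⇒≱ u≺v v⪯u)
          ... | a , b , (a*≺a , a⪯u) , b∉ , b≢a* , adj with outside-lopen b∉ b≢a*
          ...   | inj₁ b≺a* with edge-from-adjacent (Adjacent-sym G adj) (<-trans b≺a* a*≺a)
          ...     | k , refl , refl =
                      no-interleaving k e₁ b≺a* a*≺a (≤-<-trans a⪯u (<-≤-trans u≺v (proj₂ spans-e₁)))
          no-exit a*≺u | a , b , (a*≺a , a⪯u) , b∉ , b≢a* , adj | inj₂ u≺b
            with edge-from-adjacent adj (≤-<-trans a⪯u u≺b)
          ...     | k , refl , refl = <⇒≱ a*≺a (e₁-outermost k (a⪯u , beyond-gap u≺b))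

        hi-e₂ : hi e₂ ≡ v
        hi-e₂ = ⪯-antisym (≮⇒≥ no-exit) (proj₂ spans-e₂)
          where
          no-exit : ¬ v ≺ hi e₂
          no-exit v≺b*
            with walk-exit G (λ w → (v ⪯? w) ×-dec (w ≺? hi e₂))
                   (connected-without (hi e₂) v u (≺⇒≢ v≺b*) (≺⇒≢ (<-trans u≺v v≺b*)))
                   (≤-refl , v≺b*) (λ (v⪯u , _) → <⇒≱ u≺v v⪯u)
          ... | a , b , (v⪯a , a≺b*) , b∉ , b≢b* , adj with outside-ropen b∉ b≢b*
          ...   | inj₂ b*≺b with edge-from-adjacent adj (<-trans a≺b* b*≺b)
          ...     | k , refl , refl =
                      no-interleaving e₂ k (≤-<-trans (proj₁ spans-e₂) (<-≤-trans u≺v v⪯a)) a≺b* b*≺b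
          no-exit v≺b* | a , b , (v⪯a , a≺b*) , b∉ , b≢b* , adj | inj₁ b≺v
            with edge-from-adjacent (Adjacent-sym G adj) (<-≤-trans b≺v v⪯a)
          ...     | k , refl , refl = <⇒≱ a≺b* (e₂-innermost k (before-gap b≺v , v⪯a))

      consecutive-edge : ∃ λ i → lo i ≡ u × hi i ≡ v
      consecutive-edge with hi e₁ ≟ᶠ v | lo e₂ ≟ᶠ u
      ... | yes hi≡v | _        = e₁ , lo-e₁ , hi≡v
      ... | no  _    | yes lo≡u = e₂ , lo≡u , hi-e₂
      ... | no  hi≢v | no  lo≢u = ⊥-elim (no-interleaving e₂ e₁
        (subst (lo e₂ ≺_) (sym lo-e₁) (⪯∧≢⇒≺ (proj₁ spans-e₂) lo≢u))
        (subst₂ _≺_ (sym lo-e₁) (sym hi-e₂) u≺v)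
        (subst (_≺ hi e₁) (sym hi-e₂) (⪯∧≢⇒≺ (proj₂ spans-e₁) (hi≢v ∘ sym))))

    private
      anyVertex : V
      anyVertex = fromℕ< (<-≤-trans (s≤s z≤n) three)

      leftmost  = minimum-on (λ _ → yes tt) pos (anyVertex , tt)
      rightmost = maximum-on (λ _ → yes tt) pos (anyVertex , tt)

    first last : V
    first = proj₁ leftmost
    last  = proj₁ rightmost

    first-⪯ : ∀ w → first ⪯ w
    first-⪯ w = proj₂ (proj₂ leftmost) w tt

    ⪯-last : ∀ w → w ⪯ last
    ⪯-last w = proj₂ (proj₂ rightmost) w tt

    first≢last : first ≢ last
    first≢last first≡last with ∃-≢₂ three first last
    ... | w , w≢first , _ =
      w≢first (⪯-antisym (subst (w ⪯_) (sym first≡last) (⪯-last w)) (first-⪯ w))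

    private
      edge-at-first : ∃ λ j → lo j ≡ first
      edge-at-first with ∃-≢₂ three first last
      ... | x , x≢first , x≢last
        with walk-exit G (_≟ᶠ first) (connected-without x first last (≢-sym x≢first) (≢-sym x≢last))
               refl (first≢last ∘ sym)
      ...   | a , b , refl , b≢first , _ , adj
        with edge-from-adjacent adj (⪯∧≢⇒≺ (first-⪯ b) (b≢first ∘ sym))
      ...     | j , lo≡first , _ = j , lo≡first

      farthest = maximum-on (λ j → lo j ≟ᶠ first) (pos ∘ hi) edge-at-first

      e* : E
      e* = proj₁ farthest

      lo-e* : lo e* ≡ first
      lo-e* = proj₁ (proj₂ farthest)

      e*-farthest : ∀ j → lo j ≡ first → hi j ⪯ hi e*
      e*-farthest = proj₂ (proj₂ farthest)

    -- A walk from last to first avoiding hi e* has to leave the vertices right of hi e*; its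
    -- exit edge would either cross e* or leave first for a vertex beyond hi e*.
    extremes-edge : ∃ λ i → lo i ≡ first × hi i ≡ last
    extremes-edge = e* , lo-e* , ⪯-antisym (⪯-last (hi e*)) (≮⇒≥ no-exit)
      where
      no-exit : ¬ hi e* ≺ last
      no-exit b*≺last
        with walk-exit G (hi e* ≺?_)
               (connected-without (hi e*) last first (≢-sym (≺⇒≢ b*≺last))
                                                     (≺⇒≢ (subst (_≺ hi e*) lo-e* (lo≺hi e*))))
               b*≺last (λ b*≺first → <⇒≱ b*≺first (first-⪯ (hi e*)))
      ... | a , b , b*≺a , b⊀ , b≢b* , adj
        with edge-from-adjacent (Adjacent-sym G adj) (<-trans (⊀∧≢⇒≻ b⊀ b≢b*) b*≺a)
      ...   | k , refl , refl with lo k ≟ᶠ first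
      ...     | yes lo≡first = <⇒≱ b*≺a (e*-farthest k lo≡first)
      ...     | no  lo≢first = no-interleaving e* k
                  (subst (_≺ lo k) (sym lo-e*) (⪯∧≢⇒≺ (first-⪯ (lo k)) (lo≢first ∘ sym)))
                  (⊀∧≢⇒≻ b⊀ b≢b*) b*≺a

    predecessor : ∀ {v} → first ≺ v → ∃ λ u → u ≺ v × NothingBetween u v
    predecessor {v} first≺v with maximum-on (_≺? v) pos (first , first≺v)
    ... | u , u≺v , u-latest = u , u≺v , λ w (u≺w , w≺v) → <⇒≱ u≺w (u-latest w w≺v)

    private
      into-first : 1 ≤ indeg G orientation first
      into-first with extremes-edge | ∃-≢₂ three first last
      ... | i , lo≡ , hi≡ | w , w≢first , w≢last = indeg≥1-of-head G orientation i (begin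
        head G orientation i  ≡⟨ head-orientation i ⟩
        headOf (shape i)      ≡⟨ head-of-extremal (shape i) not-consecutive extremal-i ⟩
        lo i                  ≡⟨ lo≡ ⟩
        first                 ∎)
        where
        open ≡-Reasoning
        extremal-i : Extremal i
        extremal-i = (λ x → subst (_⪯ x) (sym lo≡) (first-⪯ x))
                   , (λ x → subst (x ⪯_) (sym hi≡) (⪯-last x))
        not-consecutive : ¬ Consecutive i
        not-consecutive nothing-between = nothing-between w
          ( subst (_≺ w) (sym lo≡) (⪯∧≢⇒≺ (first-⪯ w) (w≢first ∘ sym))
          , subst (w ≺_) (sym hi≡) (⪯∧≢⇒≺ (⪯-last w) w≢last))

      into-later : ∀ {v} → first ≺ v → 1 ≤ indeg G orientation v
      into-later first≺v with predecessor first≺v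
      ... | u , u≺v , gap with consecutive-edge u≺v gap
      ...   | i , refl , refl =
                indeg≥1-of-head G orientation i
                  (trans (head-orientation i) (head-of-consecutive (shape i) gap))

    indeg≥1 : ∀ v → 1 ≤ indeg G orientation v
    indeg≥1 v with v ≟ᶠ first
    ... | yes refl    = into-first
    ... | no  v≢first = into-later (⪯∧≢⇒≺ (first-⪯ v) (v≢first ∘ sym))

theorem1p4 : (G : Graph) → TwoConnected G → Bipartite G → Outerplanar G →
    TruncatedDegreeAT 4 G
theorem1p4 G (three , _ , connected-without) bipartite (pos , pos-injective , noncrossing) =
  orientation , bipartite⇒AT G bipartite orientation , λ v →
    ⊓-glb (s≤s (outdeg≤3 v)) (indeg≥1⇒outdeg<deg G orientation v (indeg≥1 three connected-without v))
  where open Layout G pos pos-injective noncrossing
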